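{- Let $G=(V,E)$ and $\rho$ be as in the context, let $\hat\rho=\frac{\rho(V)}{2}-|V|+1$ and let $b'(Z)=|V(Z)|-\mathrm{comp}(Z)+\hat\rho$ for nonempty $Z\subseteq E$, $b'(\emptyset)=0$. Let $B(b')=\{x\in\mathbb{R}^E\mid x(Y)\le b'(Y)\ \forall Y\subseteq E,\ x(E)=b'(E)\}$ and $B=\{x\in\mathbb{Z}^E_{\ge0}\mid x(E)=\frac{\rho(V)}{2},\ \mathrm{supp}(x)\text{ is connected}\}$. Then $B=B(b')\cap\mathbb{Z}^E_{\ge0}$.
   Context: $G=(V,E)$ is a finite complete undirected graph whose edge set also contains a self-loop at every vertex; $\rho:V\to\mathbb{Z}_{\ge0}$ with $\rho(V)=\sum_v\rho(v)$ even. For $F\subseteq E$, $V(F)$ is the set of vertices covered by edges of $F$, and $\mathrm{comp}(F)$ is the number of connected components of $(V(F),F)$. "$\mathrm{supp}(x)$ is connected" means the graph $(V,\{e:x(e)\ne0\})$ is connected. $x(Y)=\sum_{e\in Y}x(e)$. -}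

module Defs where

open import Data.Nat as ℕ using (ℕ; zero; suc; _≤?_; ⌊_/2⌋)
open import Data.Integer as ℤ using (ℤ; +_)
open import Data.Fin using (Fin; toℕ; _<?_)
import Data.Fin as Fin
open import Data.Bool using (Bool; true; false; _∧_; _∨_; not; if_then_else_)
open import Data.List using (List; []; _∷_; [_]; concatMap; map; foldr; length; filter)
open import Data.Bool.ListAction using (any; all)
open import Data.List.Base using (allFin)
open import Data.Product using (Σ; _×_; _,_)
open import Data.Sum using (_⊎_)
open import Relation.Binary.PropositionalEquality using (_≡_; _≢_)
open import Relation.Nullary.Decidable using (⌊_⌋)
open import Relation.Binary.Construct.Closure.ReflexiveTransitive using (Star)

-- Vertex set V = Fin n.  Edges of the complete graph with a self-loop at
-- every vertex: unordered pairs {i,j} (i = j allowed), represented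
-- canonically as (i , j) with i ≤ j.
record Edge (n : ℕ) : Set where
  constructor edge
  field
    fst : Fin n
    snd : Fin n
    ord : toℕ fst ℕ.≤ toℕ snd
open Edge public

allEdges : (n : ℕ) → List (Edge n)
allEdges n = concatMap (λ i → concatMap (pick i) (allFin n)) (allFin n)
  where
  pick : Fin n → Fin n → List (Edge n)
  pick i j with toℕ i ≤? toℕ j
  ... | Relation.Nullary.Decidable.yes p = [ edge i j p ]
  ... | Relation.Nullary.Decidable.no _ = []

EdgeSet : ℕ → Set
EdgeSet n = Edge n → Bool

fullE : {n : ℕ} → EdgeSet n
fullE _ = true

sumℕ : List ℕ → ℕ
sumℕ = foldr ℕ._+_ 0

xSum : {n : ℕ} → (Edge n → ℕ) → EdgeSet n → ℕ
xSum {n} x Y = sumℕ (map (λ e → if Y e then x e else 0) (allEdges n))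

ρV : {n : ℕ} → (Fin n → ℕ) → ℕ
ρV {n} ρ = sumℕ (map ρ (allFin n))

endsB : {n : ℕ} → Edge n → Fin n → Fin n → Bool
endsB e u v = (⌊ fst e Fin.≟ u ⌋ ∧ ⌊ snd e Fin.≟ v ⌋) ∨ (⌊ fst e Fin.≟ v ⌋ ∧ ⌊ snd e Fin.≟ u ⌋)

coveredB : {n : ℕ} → EdgeSet n → Fin n → Bool
coveredB {n} F v = any (λ e → F e ∧ (⌊ fst e Fin.≟ v ⌋ ∨ ⌊ snd e Fin.≟ v ⌋)) (allEdges n)

numV : {n : ℕ} → EdgeSet n → ℕ
numV {n} F = length (filter (λ v → coveredB F v Data.Bool.≟ true) (allFin n))

adjB : {n : ℕ} → EdgeSet n → Fin n → Fin n → Bool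
adjB {n} F u v = any (λ e → F e ∧ endsB e u v) (allEdges n)

reachB : {n : ℕ} → ℕ → EdgeSet n → Fin n → Fin n → Bool
reachB zero F u v = ⌊ u Fin.≟ v ⌋
reachB {n} (suc k) F u v =
  reachB k F u v ∨ any (λ w → reachB k F u w ∧ adjB F w v) (allFin n)

-- u and v lie in the same component of (V(F), F)
-- (walks of length ≤ n suffice, since there are n vertices).
connB : {n : ℕ} → EdgeSet n → Fin n → Fin n → Bool
connB {n} F = reachB n F

-- comp(F): number of connected components of (V(F), F), counted by their
-- least vertex: v ∈ V(F) with no smaller vertex in its component.
comp : {n : ℕ} → EdgeSet n → ℕ
comp {n} F = length (filter (λ v → isLeast v Data.Bool.≟ true) (allFin n))
  where
  isLeast : Fin n → Bool
  isLeast v = coveredB F v ∧ all (λ u → not (⌊ u <? v ⌋ ∧ connB F u v)) (allFin n)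

-- ρ̂ = ρ(V)/2 - |V| + 1   (ρ(V) is assumed even)
ρhat : {n : ℕ} → (Fin n → ℕ) → ℤ
ρhat {n} ρ = (+ ⌊ ρV ρ /2⌋ ℤ.- + n) ℤ.+ + 1

b' : {n : ℕ} → (Fin n → ℕ) → EdgeSet n → ℤ
b' {n} ρ Z with any Z (allEdges n)
... | false = + 0
... | true  = (+ numV Z ℤ.- + comp Z) ℤ.+ ρhat ρ

InBb' : {n : ℕ} → (Fin n → ℕ) → (Edge n → ℕ) → Set
InBb' ρ x = ((Y : EdgeSet _) → + xSum x Y ℤ.≤ b' ρ Y) × (+ xSum x fullE ≡ b' ρ fullE)

SuppAdj : {n : ℕ} → (Edge n → ℕ) → Fin n → Fin n → Set
SuppAdj x u v = Σ (Edge _) λ e → (x e ≢ 0) × ((fst e ≡ u × snd e ≡ v) ⊎ (fst e ≡ v × snd e ≡ u))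

SuppConnected : {n : ℕ} → (Edge n → ℕ) → Set
SuppConnected {n} x = (u v : Fin n) → Star (SuppAdj x) u v

InB : {n : ℕ} → (Fin n → ℕ) → (Edge n → ℕ) → Set
InB ρ x = (xSum x fullE ≡ ⌊ ρV ρ /2⌋) × SuppConnected x

module Submission where

-- Write κ(F) for the number of connected components of (V, F), isolated vertices included.
-- Since comp(F) + |V| = κ(F) + |V(F)|, for Y ≠ ∅ the inequality x(Y) ≤ b'(Y) reads
-- x(Y) + κ(Y) ≤ ρ(V)/2 + 1, and b'(E) = ρ(V)/2 because the complete graph is connected.
-- If supp(x) is connected, adding to Y the support edges outside Y one at a time lowers
-- κ by at most one per edge, and each of them carries x ≥ 1; as Y together with these
-- edges is connected, κ(Y) ≤ 1 + x(E ∖ Y) = 1 + ρ(V)/2 - x(Y).  Conversely, for Y the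
-- support together with all loops, x(Y) = ρ(V)/2 forces κ(Y) ≤ 1, and loops connect
-- nothing, so supp(x) is connected.

open import Defs
open import Data.Nat using (ℕ)
open import Data.Nat.Divisibility using (_∣_)
open import Data.Fin using (Fin)
open import Function.Bundles using (_⇔_)

open import Data.Bool as Bool using (Bool; true; false; T; T?; not; _∧_; _∨_; if_then_else_)
open import Data.Bool.Properties using (T-∧; T-∨)
open import Data.Bool.ListAction using (any; all)
open import Data.Empty using (⊥-elim)
open import Data.Fin as Fin using (toℕ; _<?_)
open import Data.Fin.Induction using (<-wellFounded)
import Data.Fin.Properties as Fin
open import Data.Integer as ℤ using (+_)
import Data.Integer.Properties as ℤ
open import Data.Integer.Tactic.RingSolver using (solve-∀)
open import Data.List using (List; []; _∷_; length; filter; filterᵇ; map; allFin)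
open import Data.List.Membership.Propositional using (_∈_; lose; find)
open import Data.List.Membership.Propositional.Properties using (∈-concatMap⁺; ∈-allFin; ∈-filter⁺)
open import Data.List.Properties using (length-tabulate; map-cong)
open import Data.List.Relation.Unary.All using (All; []; _∷_)
import Data.List.Relation.Unary.All as All
import Data.List.Relation.Unary.All.Properties as All
open import Data.List.Relation.Unary.AllPairs using ([]; _∷_)
open import Data.List.Relation.Unary.Any using (Any; here; there)
import Data.List.Relation.Unary.Any.Properties as Any
open import Data.List.Relation.Unary.Unique.Propositional using (Unique)
open import Data.List.Relation.Unary.Unique.Propositional.Properties using (allFin⁺)
open import Data.Nat as ℕ using (zero; suc; _+_; _≤_; _<_; z≤n; s≤s; ⌊_/2⌋)
import Data.Nat.Properties as ℕ
open import Algebra.Properties.CommutativeSemigroup ℕ.+-commutativeSemigroup using (x∙yz≈y∙xz)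
open import Data.Product using (∃-syntax; _×_; _,_)
open import Data.Sum using (_⊎_; inj₁; inj₂)
open import Function.Base using (id; _∘_)
open import Function.Bundles using (Equivalence; mk⇔)
open import Induction.WellFounded using (Acc; acc)
open import Relation.Binary.Construct.Closure.ReflexiveTransitive as Star using (Star; ε; _◅_; _◅◅_; _⋆)
open import Relation.Binary.Definitions using (DecidableEquality; tri<; tri≈; tri>)
open import Relation.Binary.PropositionalEquality
open import Relation.Nullary using (¬_; yes; no; contradiction)
open import Relation.Nullary.Decidable using (⌊_⌋; dec-yes-irr; toWitness; fromWitness)

open Equivalence using (to; from)

private variable
  A : Set
  p q : A → Bool
  a b : A
  xs : List A
  n k : ℕ
  F : EdgeSet n
  e : Edge n
  es : List (Edge n)
  u v w x y : Fin n

count : (A → Bool) → List A → ℕ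
count p []       = 0
count p (a ∷ xs) = if p a then suc (count p xs) else count p xs

length-filter≡count : ∀ (p : A → Bool) xs → length (filter (λ a → p a Bool.≟ true) xs) ≡ count p xs
length-filter≡count p []       = refl
length-filter≡count p (a ∷ xs) with p a
... | true  = cong suc (length-filter≡count p xs)
... | false = length-filter≡count p xs

count≤length : ∀ (p : A → Bool) xs → count p xs ≤ length xs
count≤length p []       = z≤n
count≤length p (a ∷ xs) with p a
... | true  = s≤s (count≤length p xs)
... | false = ℕ.m≤n⇒m≤1+n (count≤length p xs)

count-all : (∀ a → T (p a)) → ∀ xs → count p xs ≡ length xs
count-all         all-p []       = refl
count-all {p = p} all-p (a ∷ xs) with p a | all-p a
... | true | _ = cong suc (count-all all-p xs)

count-mono : (∀ a → T (p a) → T (q a)) → ∀ xs → count p xs ≤ count q xs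
count-mono                 p⊆q []       = z≤n
count-mono {p = p} {q = q} p⊆q (a ∷ xs) with p a | q a | p⊆q a
... | true  | true  | _   = s≤s (count-mono p⊆q xs)
... | true  | false | p⊈q = ⊥-elim (p⊈q _)
... | false | true  | _   = ℕ.m≤n⇒m≤1+n (count-mono p⊆q xs)
... | false | false | _   = count-mono p⊆q xs

count-mono-< : (∀ a → T (p a) → T (q a)) → b ∈ xs → ¬ T (p b) → T (q b) → count p xs < count q xs
count-mono-< {p = p} {q = q} {xs = a ∷ xs} p⊆q (here refl) ¬pa qa with p a | q a
... | false | true = s≤s (count-mono p⊆q xs)
... | true  | _    = contradiction _ ¬pa
count-mono-< {p = p} {q = q} {xs = a ∷ xs} p⊆q (there b∈xs) ¬pb qb with p a | q a | p⊆q a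
... | true  | true  | _   = s≤s (count-mono-< p⊆q b∈xs ¬pb qb)
... | true  | false | p⊈q = ⊥-elim (p⊈q _)
... | false | true  | _   = ℕ.m≤n⇒m≤1+n (count-mono-< p⊆q b∈xs ¬pb qb)
... | false | false | _   = count-mono-< p⊆q b∈xs ¬pb qb

count-⊆-≥ : (∀ a → T (p a) → T (q a)) → count q xs ≤ count p xs → b ∈ xs → T (q b) → T (p b)
count-⊆-≥ {p = p} {b = b} p⊆q q≤p b∈xs qb with p b in pb
... | true  = _
... | false = contradiction q≤p (ℕ.<⇒≱ (count-mono-< p⊆q b∈xs (subst T pb) qb))

count>0 : a ∈ xs → T (p a) → 0 < count p xs
count>0 {xs = a ∷ _}  {p = p} (here refl)  pa with p a
... | true = s≤s z≤n
count>0 {xs = c ∷ xs} {p = p} (there a∈xs) pa with p c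
... | true  = s≤s z≤n
... | false = count>0 a∈xs pa

count≥2 : a ∈ xs → b ∈ xs → a ≢ b → T (p a) → T (p b) → 2 ≤ count p xs
count≥2                       (here refl)  (here refl)  a≢a _  _  = contradiction refl a≢a
count≥2 {xs = c ∷ _}  {p = p} (here refl)  (there b∈xs) _   pa pb with p c
... | true = s≤s (count>0 b∈xs pb)
count≥2 {xs = c ∷ _}  {p = p} (there a∈xs) (here refl)  _   pa pb with p c
... | true = s≤s (count>0 a∈xs pa)
count≥2 {xs = c ∷ xs} {p = p} (there a∈xs) (there b∈xs) a≢b pa pb with p c
... | true  = ℕ.m≤n⇒m≤1+n (count≥2 a∈xs b∈xs a≢b pa pb)
... | false = count≥2 a∈xs b∈xs a≢b pa pb

count≡0 : All (λ a → ¬ T (p a)) xs → count p xs ≡ 0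
count≡0                       []           = refl
count≡0 {p = p} {xs = a ∷ _} (¬pa ∷ ¬pxs) with p a
... | true  = contradiction _ ¬pa
... | false = count≡0 ¬pxs

count≤1 : (∀ a b → T (p a) → T (p b) → a ≡ b) → Unique xs → count p xs ≤ 1
count≤1                       p-unique []           = z≤n
count≤1 {p = p} {xs = a ∷ _} p-unique (a∉xs ∷ xs!) with p a in pa
... | false = count≤1 p-unique xs!
... | true  = s≤s (ℕ.≤-reflexive (count≡0 (All.map (λ a≢b pb → a≢b (p-unique _ _ (subst T (sym pa) _) pb)) a∉xs)))

count-∧+count-∨ : ∀ (p q : A → Bool) xs →
                  count (λ a → p a ∧ q a) xs + count (λ a → p a ∨ q a) xs ≡ count p xs + count q xs
count-∧+count-∨ p q []       = refl
count-∧+count-∨ p q (a ∷ xs) with p a | q a | count-∧+count-∨ p q xs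
... | true  | true  | ih = cong suc (trans (ℕ.+-suc _ _) (trans (cong suc ih) (sym (ℕ.+-suc _ _))))
... | true  | false | ih = trans (ℕ.+-suc _ _) (cong suc ih)
... | false | true  | ih = trans (ℕ.+-suc _ _) (trans (cong suc ih) (sym (ℕ.+-suc _ _)))
... | false | false | ih = ih

count-∨ : ∀ (p q : A → Bool) xs → count (λ a → p a ∨ q a) xs ≤ count p xs + count q xs
count-∨ p q xs = begin
  count (λ a → p a ∨ q a) xs                              ≤⟨ ℕ.m≤n+m _ _ ⟩
  count (λ a → p a ∧ q a) xs + count (λ a → p a ∨ q a) xs ≡⟨ count-∧+count-∨ p q xs ⟩
  count p xs + count q xs                                 ∎
  where open ℕ.≤-Reasoning

count-≤+1 : (∀ a b → T (p a) → ¬ T (q a) → T (p b) → ¬ T (q b) → a ≡ b) → Unique xs →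
            count p xs ≤ count q xs + 1
count-≤+1 {p = p} {q = q} {xs = xs} excess-unique xs! = begin
  count p xs                         ≤⟨ count-mono within xs ⟩
  count (λ a → q a ∨ excess a) xs    ≤⟨ count-∨ q excess xs ⟩
  count q xs + count excess xs       ≤⟨ ℕ.+-monoʳ-≤ (count q xs) (count≤1 excess-unique′ xs!) ⟩
  count q xs + 1                     ∎
  where
  open ℕ.≤-Reasoning
  excess : _ → Bool
  excess a = p a ∧ not (q a)
  excess⁻ : ∀ a → T (excess a) → T (p a) × ¬ T (q a)
  excess⁻ a h with p a | q a
  ... | true | false = _ , λ ()
  within : ∀ a → T (p a) → T (q a ∨ excess a)
  within a pa with p a | q a
  ... | true | true  = _
  ... | true | false = _
  excess-unique′ : ∀ a b → T (excess a) → T (excess b) → a ≡ b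
  excess-unique′ a b ea eb =
    let pa , ¬qa = excess⁻ a ea ; pb , ¬qb = excess⁻ b eb in excess-unique a b pa ¬qa pb ¬qb

all-not⊎any : ∀ (p : A → Bool) xs → T (all (λ a → not (p a)) xs) ⊎ Any (λ a → T (p a)) xs
all-not⊎any p []       = inj₁ _
all-not⊎any p (a ∷ xs) with p a in pa
... | true  = inj₂ (here (subst T (sym pa) _))
... | false with all-not⊎any p xs
...   | inj₁ none = inj₁ none
...   | inj₂ some = inj₂ (there some)

sum-split : ∀ (f : A → ℕ) (p : A → Bool) xs →
            sumℕ (map f xs) ≡ sumℕ (map (λ a → if p a then f a else 0) xs) + sumℕ (map (λ a → if p a then 0 else f a) xs)
sum-split f p []       = refl
sum-split f p (a ∷ xs) with p a | sum-split f p xs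
... | true  | ih = trans (cong (f a ℕ.+_) ih) (sym (ℕ.+-assoc (f a) _ _))
... | false | ih = trans (cong (f a ℕ.+_) ih) (x∙yz≈y∙xz (f a) (sumℕ (map (λ a → if p a then f a else 0) xs)) _)

sum-zero : ∀ (f : A → ℕ) xs → (∀ a → f a ≡ 0) → sumℕ (map f xs) ≡ 0
sum-zero f []       f≡0 = refl
sum-zero f (a ∷ xs) f≡0 = cong₂ _+_ (f≡0 a) (sum-zero f xs f≡0)

length-filter≤sum : ∀ (p : A → Bool) (f : A → ℕ) xs → (∀ a → T (p a) → 0 < f a) →
                    length (filterᵇ p xs) ≤ sumℕ (map f xs)
length-filter≤sum p f []       p⇒pos = z≤n
length-filter≤sum p f (a ∷ xs) p⇒pos with p a in pa
... | true  = ℕ.+-mono-≤ (p⇒pos a (subst T (sym pa) _)) (length-filter≤sum p f xs p⇒pos)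
... | false = ℕ.≤-trans (length-filter≤sum p f xs p⇒pos) (ℕ.m≤n+m _ (f a))

mutual
  ∈-allEdges : (e : Edge n) → e ∈ allEdges n
  ∈-allEdges (edge i j i≤j) =
    ∈-concatMap⁺ _ (Any.tabulate⁺ i (∈-concatMap⁺ _ (Any.tabulate⁺ j (edge∈pick i j i≤j))))

  edge∈pick : (i j : Fin n) (i≤j : toℕ i ≤ toℕ j) → edge i j i≤j ∈ _
  edge∈pick i j i≤j with toℕ i ℕ.≤? toℕ j | dec-yes-irr (toℕ i ℕ.≤? toℕ j) ℕ.≤-irrelevant i≤j
  ... | _ | refl = here refl

_≟ₑ_ : DecidableEquality (Edge n)
edge i j i≤j ≟ₑ edge i′ j′ i′≤j′ with i Fin.≟ i′ | j Fin.≟ j′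
... | yes refl | yes refl = yes (cong (edge i j) (ℕ.≤-irrelevant i≤j i′≤j′))
... | no i≢i′  | _        = no (i≢i′ ∘ cong fst)
... | yes _    | no j≢j′  = no (j≢j′ ∘ cong snd)

data Ends (e : Edge n) : Fin n → Fin n → Set where
  forward  : Ends e (fst e) (snd e)
  backward : Ends e (snd e) (fst e)

ends-sym : Ends e u v → Ends e v u
ends-sym forward  = backward
ends-sym backward = forward

module _ {e : Edge n} {u v : Fin n} where
  private
    fu = ⌊ fst e Fin.≟ u ⌋
    sv = ⌊ snd e Fin.≟ v ⌋
    fv = ⌊ fst e Fin.≟ v ⌋

  ends⁺ : Ends e u v → T (endsB e u v)
  ends⁺ forward  = from (T-∨ {fu ∧ sv}) (inj₁ (from (T-∧ {fu}) (fromWitness refl , fromWitness refl)))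
  ends⁺ backward = from (T-∨ {fu ∧ sv}) (inj₂ (from (T-∧ {fv}) (fromWitness refl , fromWitness refl)))

  ends⁻ : T (endsB e u v) → Ends e u v
  ends⁻ h with to (T-∨ {fu ∧ sv}) h
  ... | inj₁ h₁ with to (T-∧ {fu}) h₁
  ...   | p , q with toWitness p | toWitness q
  ...     | refl | refl = forward
  ends⁻ h | inj₂ h₂ with to (T-∧ {fv}) h₂
  ...   | p , q with toWitness p | toWitness q
  ...     | refl | refl = backward

data Adj (F : EdgeSet n) (u v : Fin n) : Set where
  adj : (e : Edge n) → T (F e) → Ends e u v → Adj F u v

Conn : EdgeSet n → Fin n → Fin n → Set
Conn F = Star (Adj F)

adjB⁺ : Adj F u v → T (adjB F u v)
adjB⁺ {F = F} (adj e Fe uv) = Any.any⁺ _ (lose (∈-allEdges e) (from (T-∧ {F e}) (Fe , ends⁺ uv)))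

adjB⁻ : T (adjB F u v) → Adj F u v
adjB⁻ {F = F} uv with find (Any.any⁻ _ (allEdges _) uv)
... | e , _ , h = let Fe , uv′ = to (T-∧ {F e}) h in adj e Fe (ends⁻ uv′)

adj-sym : Adj F u v → Adj F v u
adj-sym (adj e Fe uv) = adj e Fe (ends-sym uv)

conn-sym : Conn F u v → Conn F v u
conn-sym = Star.reverse adj-sym

-- Walks of bounded length

module Reach (F : EdgeSet n) (u : Fin n) where

  reach : ℕ → Fin n → Bool
  reach k = reachB k F u

  reach-suc : ∀ k → T (reach k v) → T (reach (suc k) v)
  reach-suc {v = v} k h = from (T-∨ {reach k v}) (inj₁ h)

  reach-step : ∀ k → T (reach k w) → Adj F w v → T (reach (suc k) v)
  reach-step {w = w} {v = v} k h wv =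
    from (T-∨ {reach k v}) (inj₂ (Any.any⁺ _ (lose (∈-allFin w) (from (T-∧ {reach k w}) (h , adjB⁺ wv)))))

  reach-suc⁻ : ∀ k → T (reach (suc k) v) → T (reach k v) ⊎ ∃[ w ] T (reach k w) × Adj F w v
  reach-suc⁻ {v = v} k h with to (T-∨ {reach k v}) h
  ... | inj₁ h₁ = inj₁ h₁
  ... | inj₂ h₂ with find (Any.any⁻ _ (allFin n) h₂)
  ...   | w , _ , h₃ = let h₄ , wv = to (T-∧ {reach k w}) h₃ in inj₂ (w , h₄ , adjB⁻ wv)

  reach⇒conn : ∀ k → T (reach k v) → Conn F u v
  reach⇒conn zero    h with toWitness h
  ... | refl = ε
  reach⇒conn (suc k) h with reach-suc⁻ k h
  ... | inj₁ h₁            = reach⇒conn k h₁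
  ... | inj₂ (w , h₂ , wv) = reach⇒conn k h₂ ◅◅ wv ◅ ε

  conn⇒reach : T (reach k w) → Conn F w v → ∃[ m ] T (reach m v)
  conn⇒reach {k = k} h ε         = k , h
  conn⇒reach {k = k} h (wx ◅ xv) = conn⇒reach {k = suc k} (reach-step k h wx) xv

  reach₀⇒reach : ∀ k → T (reach 0 v) → T (reach k v)
  reach₀⇒reach zero    h = h
  reach₀⇒reach (suc k) h = reach-suc k (reach₀⇒reach k h)

  Saturated : ℕ → Set
  Saturated k = ∀ m v → T (reach m v) → T (reach k v)

  stalled⇒saturated : ∀ k → (∀ v → T (reach (suc k) v) → T (reach k v)) → Saturated k
  stalled⇒saturated k stalled zero    v h = reach₀⇒reach k h
  stalled⇒saturated k stalled (suc m) v h with reach-suc⁻ m h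
  ... | inj₁ h₁            = stalled⇒saturated k stalled m v h₁
  ... | inj₂ (w , h₂ , wv) = stalled v (reach-step k (stalled⇒saturated k stalled m w h₂) wv)

  -- Once the set of vertices reachable in k steps stops growing it stays fixed; it can grow
  -- at most n times, so it is fixed from k = n on.
  grows-or-saturated : ∀ k → k < count (reach k) (allFin n) ⊎ Saturated k
  grows-or-saturated zero = inj₁ (count>0 (∈-allFin u) (fromWitness refl))
  grows-or-saturated (suc k) with grows-or-saturated k
  ... | inj₂ saturated = inj₂ λ m v h → reach-suc k (saturated m v h)
  ... | inj₁ k<count with count (reach (suc k)) (allFin n) ℕ.≤? count (reach k) (allFin n)
  ...   | no grew     = inj₁ (ℕ.≤-trans (s≤s k<count) (ℕ.≰⇒> grew))
  ...   | yes stalled = inj₂ λ m v h → reach-suc k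
          (stalled⇒saturated k (λ v → count-⊆-≥ (λ _ → reach-suc k) stalled (∈-allFin v)) m v h)

  reach-saturates : Saturated n
  reach-saturates with grows-or-saturated n
  ... | inj₂ saturated = saturated
  ... | inj₁ n<count   = contradiction (subst (n <_) (length-tabulate id) n<length) (ℕ.<-irrefl refl)
    where n<length = ℕ.≤-trans n<count (count≤length (reach n) (allFin n))

conn⇒connB : Conn F u v → T (connB F u v)
conn⇒connB {F = F} {u = u} {v = v} uv =
  let m , h = Reach.conn⇒reach F u {k = 0} (fromWitness refl) uv in Reach.reach-saturates F u m v h

connB⇒conn : ∀ {n} {F : EdgeSet n} {u v} → T (connB F u v) → Conn F u v
connB⇒conn {n} {F} {u} = Reach.reach⇒conn F u n

-- Components of (V, F), isolated vertices included

-- A component is counted by its least vertex, as in comp, but that vertex need not be covered.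
least : EdgeSet n → Fin n → Bool
least {n} F v = all (λ u → not (⌊ u <? v ⌋ ∧ connB F u v)) (allFin n)

components : EdgeSet n → ℕ
components {n} F = count (least F) (allFin n)

least-or-below : ∀ (F : EdgeSet n) v → T (least F v) ⊎ ∃[ u ] u Fin.< v × Conn F u v
least-or-below {n} F v with all-not⊎any (λ u → ⌊ u <? v ⌋ ∧ connB F u v) (allFin n)
... | inj₁ none = inj₁ none
... | inj₂ some with find some
...   | u , _ , h = let u<v , uv = to (T-∧ {⌊ u <? v ⌋}) h in inj₂ (u , toWitness u<v , connB⇒conn uv)

least⇒minimal : T (least F v) → u Fin.< v → ¬ Conn F u v
least⇒minimal {F = F} {v = v} {u = u} lv u<v uv =
  not-both (All.lookup (All.all⁺ _ _ lv) (∈-allFin u)) (from (T-∧ {⌊ u <? v ⌋}) (fromWitness u<v , conn⇒connB uv))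
  where
  not-both : ∀ {b} → T (not b) → ¬ T b
  not-both {true}  ()
  not-both {false} _ ()

minimal⇒least : (∀ u → u Fin.< v → ¬ Conn F u v) → T (least F v)
minimal⇒least {v = v} {F = F} minimal with least-or-below F v
... | inj₁ lv             = lv
... | inj₂ (u , u<v , uv) = contradiction uv (minimal u u<v)

least-unique : T (least F x) → T (least F y) → Conn F x y → x ≡ y
least-unique {x = x} {y = y} lx ly xy with Fin.<-cmp x y
... | tri< x<y _ _ = contradiction xy (least⇒minimal ly x<y)
... | tri≈ _ x≡y _ = x≡y
... | tri> _ _ y<x = contradiction (conn-sym xy) (least⇒minimal lx y<x)

least-representative : ∀ (F : EdgeSet n) w → ∃[ l ] T (least F l) × Conn F l w
least-representative F w = go w (<-wellFounded w)
  where
  go : ∀ w → Acc Fin._<_ w → ∃[ l ] T (least F l) × Conn F l w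
  go w (acc below) with least-or-below F w
  ... | inj₁ lw             = w , lw , ε
  ... | inj₂ (u , u<w , uw) = let l , ll , lu = go u (below u<w) in l , ll , lu ◅◅ uw

components>0 : {F : EdgeSet n} → Fin n → 0 < components F
components>0 {F = F} w = let l , ll , _ = least-representative F w in count>0 (∈-allFin l) ll

disconnected⇒components≥2 : ¬ Conn F u v → 2 ≤ components F
disconnected⇒components≥2 {F = F} {u = u} {v = v} ¬uv
  with least-representative F u | least-representative F v
... | l , ll , lu | l′ , ll′ , l′v = count≥2 (∈-allFin l) (∈-allFin l′) l≢l′ ll ll′
  where
  l≢l′ : l ≢ l′
  l≢l′ refl = ¬uv (conn-sym lu ◅◅ l′v)

connected⇒components≤1 : (∀ v → Conn F w v) → components F ≤ 1
connected⇒components≤1 {F = F} {w = w} connected = count≤1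
  (λ x y lx ly → least-unique lx ly (conn-sym (connected x) ◅◅ connected y)) (allFin⁺ _)

components≤1⇒connected : components F ≤ 1 → Conn F u v
components≤1⇒connected {F = F} {u = u} {v = v} ≤1 with T? (connB F u v)
... | yes uv = connB⇒conn uv
... | no ¬uv = contradiction (ℕ.≤-trans (disconnected⇒components≥2 {F = F} (¬uv ∘ conn⇒connB)) ≤1) λ { (s≤s ()) }

adj⇒covered : Adj F u v → T (coveredB F u)
adj⇒covered {F = F} {u = u} (adj e Fe uv) =
  Any.any⁺ _ (lose (∈-allEdges e) (from (T-∧ {F e}) (Fe , endpoint uv)))
  where
  endpoint : Ends e u v → T (⌊ fst e Fin.≟ u ⌋ ∨ ⌊ snd e Fin.≟ u ⌋)
  endpoint forward  = from (T-∨ {⌊ fst e Fin.≟ u ⌋}) (inj₁ (fromWitness refl))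
  endpoint backward = from (T-∨ {⌊ fst e Fin.≟ u ⌋}) (inj₂ (fromWitness refl))

conn⇒covered : Conn F u v → u ≢ v → T (coveredB F u)
conn⇒covered ε        u≢u = contradiction refl u≢u
conn⇒covered (uw ◅ _) _   = adj⇒covered uw

covered-or-least : ∀ (F : EdgeSet n) v → T (coveredB F v ∨ least F v)
covered-or-least F v with T? (coveredB F v)
... | yes covered = from (T-∨ {coveredB F v}) (inj₁ covered)
... | no isolated = from (T-∨ {coveredB F v}) (inj₂ (minimal⇒least {v = v} {F = F} λ u u<v uv →
                      isolated (conn⇒covered (conn-sym uv) (Fin.<⇒≢ u<v ∘ sym))))

comp+n≡components+numV : ∀ (F : EdgeSet n) → comp F + n ≡ components F + numV F
comp+n≡components+numV {n} F = begin
  comp F + n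
    ≡⟨ cong₂ _+_ (length-filter≡count _ (allFin n))
                 (trans (sym (length-tabulate id)) (sym (count-all (covered-or-least F) (allFin n)))) ⟩
  count (λ v → coveredB F v ∧ least F v) (allFin n) + count (λ v → coveredB F v ∨ least F v) (allFin n)
    ≡⟨ count-∧+count-∨ (coveredB F) (least F) (allFin n) ⟩
  count (coveredB F) (allFin n) + components F
    ≡⟨ cong (_+ components F) (sym (length-filter≡count _ (allFin n))) ⟩
  numV F + components F
    ≡⟨ ℕ.+-comm (numV F) (components F) ⟩
  components F + numV F
    ∎
  where open ≡-Reasoning

-- Inserting edges

insert : Edge n → EdgeSet n → EdgeSet n
insert e F e′ = ⌊ e′ ≟ₑ e ⌋ ∨ F e′

adj-insert⁻ : Adj (insert e F) u v → Adj F u v ⊎ Ends e u v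
adj-insert⁻ {e = e} (adj e′ Fe′ uv) with e′ ≟ₑ e
... | yes refl = inj₂ uv
... | no _     = inj₁ (adj e′ Fe′ uv)

Crosses : Edge n → EdgeSet n → Fin n → Fin n → Set
Crosses e F u v = ∃[ a ] ∃[ b ] Ends e a b × Conn F u a × Conn F b v

conn-insert⁻ : Conn (insert e F) u v → Conn F u v ⊎ Crosses e F u v
conn-insert⁻ ε = inj₁ ε
conn-insert⁻ (uw ◅ wv) with adj-insert⁻ uw | conn-insert⁻ wv
... | inj₁ uw′      | inj₁ wv′                            = inj₁ (uw′ ◅ wv′)
... | inj₁ uw′      | inj₂ (a , b , ab , wa , bv)         = inj₂ (a , b , ab , uw′ ◅ wa , bv)
... | inj₂ uw′      | inj₁ wv′                            = inj₂ (_ , _ , uw′ , ε , wv′)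
... | inj₂ forward  | inj₂ (_ , _ , forward  , _ , bv) = inj₂ (_ , _ , forward , ε , bv)
... | inj₂ forward  | inj₂ (_ , _ , backward , _ , bv) = inj₁ bv
... | inj₂ backward | inj₂ (_ , _ , forward  , _ , bv) = inj₁ bv
... | inj₂ backward | inj₂ (_ , _ , backward , _ , bv) = inj₂ (_ , _ , backward , ε , bv)

JoinedBelow : Edge n → EdgeSet n → Fin n → Set
JoinedBelow e F v = ∃[ u ] u Fin.< v × Crosses e F u v

¬least-insert⇒joinedBelow : T (least F v) → ¬ T (least (insert e F) v) → JoinedBelow e F v
¬least-insert⇒joinedBelow {F = F} {v = v} {e = e} lv ¬lv′ with least-or-below (insert e F) v
... | inj₁ lv′ = contradiction lv′ ¬lv′
... | inj₂ (u , u<v , uv) with conn-insert⁻ uv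
...   | inj₁ uv′   = contradiction uv′ (least⇒minimal lv u<v)
...   | inj₂ cross = u , u<v , cross

least-no-crossing : T (least F x) → T (least F y) → u Fin.< x → w Fin.< y → Conn F u y → ¬ Conn F w x
least-no-crossing {x = x} {y = y} {u = u} {w = w} lx ly u<x w<y uy wx = ℕ.<-irrefl refl (begin-strict
  toℕ y ≤⟨ ℕ.≮⇒≥ (λ u<y → least⇒minimal ly u<y uy) ⟩
  toℕ u <⟨ u<x ⟩
  toℕ x ≤⟨ ℕ.≮⇒≥ (λ w<x → least⇒minimal lx w<x wx) ⟩
  toℕ w <⟨ w<y ⟩
  toℕ y ∎)
  where open ℕ.≤-Reasoning

-- Such a vertex is the least vertex of one of the two F-components joined by e: two of them on
-- the same side of e coincide, and two on opposite sides contradict least-no-crossing.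
joinedBelow-unique : T (least F x) → T (least F y) → JoinedBelow e F x → JoinedBelow e F y → x ≡ y
joinedBelow-unique lx ly (u , u<x , _ , _ , forward , ua , bx) (w , w<y , _ , _ , forward , wa , by) =
  least-unique lx ly (conn-sym bx ◅◅ by)
joinedBelow-unique lx ly (u , u<x , _ , _ , backward , ua , bx) (w , w<y , _ , _ , backward , wa , by) =
  least-unique lx ly (conn-sym bx ◅◅ by)
joinedBelow-unique lx ly (u , u<x , _ , _ , forward , ua , bx) (w , w<y , _ , _ , backward , wa , by) =
  contradiction (wa ◅◅ bx) (least-no-crossing lx ly u<x w<y (ua ◅◅ by))
joinedBelow-unique lx ly (u , u<x , _ , _ , backward , ua , bx) (w , w<y , _ , _ , forward , wa , by) =
  contradiction (wa ◅◅ bx) (least-no-crossing lx ly u<x w<y (ua ◅◅ by))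

components-insert : ∀ e (F : EdgeSet n) → components F ≤ components (insert e F) + 1
components-insert e F = count-≤+1 {p = least F} {q = least (insert e F)} (λ x y lx ¬lx′ ly ¬ly′ →
  joinedBelow-unique {F = F} lx ly (¬least-insert⇒joinedBelow {e = e} lx ¬lx′)
                                   (¬least-insert⇒joinedBelow {e = e} ly ¬ly′)) (allFin⁺ _)

insertAll : List (Edge n) → EdgeSet n → EdgeSet n
insertAll []       F = F
insertAll (e ∷ es) F = insert e (insertAll es F)

components-insertAll : ∀ es (F : EdgeSet n) → components F ≤ components (insertAll es F) + length es
components-insertAll []       F = ℕ.≤-reflexive (sym (ℕ.+-identityʳ _))
components-insertAll (e ∷ es) F = begin
  components F                                        ≤⟨ components-insertAll es F ⟩
  components (insertAll es F) + length es             ≤⟨ ℕ.+-monoˡ-≤ (length es) (components-insert e _) ⟩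
  components (insertAll (e ∷ es) F) + 1 + length es   ≡⟨ ℕ.+-assoc _ 1 (length es) ⟩
  components (insertAll (e ∷ es) F) + length (e ∷ es) ∎
  where open ℕ.≤-Reasoning

insertAll-⊇ : ∀ es → T (F e) → T (insertAll es F e)
insertAll-⊇         []        Fe = Fe
insertAll-⊇ {e = e} (e′ ∷ es) Fe = from (T-∨ {⌊ e ≟ₑ e′ ⌋}) (inj₂ (insertAll-⊇ es Fe))

∈⇒insertAll : e ∈ es → T (insertAll es F e)
∈⇒insertAll {e = e} (here refl)           = from (T-∨ {⌊ e ≟ₑ e ⌋}) (inj₁ (fromWitness refl))
∈⇒insertAll {e = e} (there {x = e′} e∈es) = from (T-∨ {⌊ e ≟ₑ e′ ⌋}) (inj₂ (∈⇒insertAll e∈es))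

i+j-j≡i : ∀ i j → i ℤ.+ j ℤ.- j ≡ i
i+j-j≡i = solve-∀

+m≤+n-+o⇔m+o≤n : ∀ m n o → (+ m ℤ.≤ + n ℤ.- + o) ⇔ (m + o ≤ n)
+m≤+n-+o⇔m+o≤n m n o = mk⇔
  (λ m≤n-o → ℤ.drop‿+≤+ (subst (+ (m + o) ℤ.≤_) (i-j+j≡i (+ n) (+ o)) (ℤ.+-monoˡ-≤ (+ o) m≤n-o)))
  (λ m+o≤n → subst (ℤ._≤ + n ℤ.- + o) (i+j-j≡i (+ m) (+ o)) (ℤ.+-monoˡ-≤ (ℤ.- + o) (ℤ.+≤+ m+o≤n)))
  where
  i-j+j≡i : ∀ i j → i ℤ.- j ℤ.+ j ≡ i
  i-j+j≡i = solve-∀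

b'-nonempty : ∀ (ρ : Fin n → ℕ) Y → T (any Y (allEdges n)) →
              b' ρ Y ≡ + (⌊ ρV ρ /2⌋ + 1) ℤ.- + components Y
b'-nonempty {n} ρ Y nonempty with any Y (allEdges n)
... | true = begin
  (+ numV Y ℤ.- + comp Y) ℤ.+ ((+ d ℤ.- + n) ℤ.+ + 1)   ≡⟨ regroup (+ numV Y) (+ comp Y) (+ n) (+ d) ⟩
  + d ℤ.+ + 1 ℤ.- (+ comp Y ℤ.+ + n ℤ.- + numV Y)      ≡⟨ cong (λ k → + d ℤ.+ + 1 ℤ.- k) comp+n-numV≡components ⟩
  + (d + 1) ℤ.- + components Y                          ∎
  where
  open ≡-Reasoning
  d = ⌊ ρV ρ /2⌋
  regroup : ∀ v c m d → (v ℤ.- c) ℤ.+ ((d ℤ.- m) ℤ.+ + 1) ≡ d ℤ.+ + 1 ℤ.- (c ℤ.+ m ℤ.- v)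
  regroup = solve-∀
  comp+n-numV≡components : + comp Y ℤ.+ + n ℤ.- + numV Y ≡ + components Y
  comp+n-numV≡components = trans (cong (λ k → + k ℤ.- + numV Y) (comp+n≡components+numV Y))
                                 (i+j-j≡i (+ components Y) (+ numV Y))

≤b'⇔ : ∀ (ρ : Fin n → ℕ) Y → T (any Y (allEdges n)) →
       ∀ m → (+ m ℤ.≤ b' ρ Y) ⇔ (m + components Y ≤ ⌊ ρV ρ /2⌋ + 1)
≤b'⇔ ρ Y nonempty m = subst (λ b → (+ m ℤ.≤ b) ⇔ (m + components Y ≤ ⌊ ρV ρ /2⌋ + 1)) (sym (b'-nonempty ρ Y nonempty))
  (+m≤+n-+o⇔m+o≤n m (⌊ ρV ρ /2⌋ + 1) (components Y))

b'-empty : ∀ (ρ : Fin n → ℕ) Y → ¬ T (any Y (allEdges n)) → b' ρ Y ≡ + 0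
b'-empty {n} ρ Y empty with any Y (allEdges n)
... | true  = contradiction _ empty
... | false = refl

complete : (u v : Fin n) → Adj fullE u v
complete u v with toℕ u ℕ.≤? toℕ v
... | yes u≤v = adj (edge u v u≤v) _ forward
... | no  u≰v = adj (edge v u (ℕ.≰⇒≥ u≰v)) _ backward

b'-fullE : ∀ (ρ : Fin n → ℕ) → Fin n → b' ρ fullE ≡ + ⌊ ρV ρ /2⌋
b'-fullE {n} ρ z = begin
  b' ρ (fullE {n})                                  ≡⟨ b'-nonempty ρ fullE nonempty ⟩
  + (⌊ ρV ρ /2⌋ + 1) ℤ.- + components (fullE {n})  ≡⟨ cong (λ k → + (⌊ ρV ρ /2⌋ + 1) ℤ.- + k) components≡1 ⟩
  + ⌊ ρV ρ /2⌋ ℤ.+ + 1 ℤ.- + 1                      ≡⟨ i+j-j≡i (+ ⌊ ρV ρ /2⌋) (+ 1) ⟩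
  + ⌊ ρV ρ /2⌋                                      ∎
  where
  open ≡-Reasoning
  nonempty : T (any fullE (allEdges n))
  nonempty = Any.any⁺ fullE (lose (∈-allEdges (edge z z ℕ.≤-refl)) _)
  components≡1 : components (fullE {n}) ≡ 1
  components≡1 = ℕ.≤-antisym (connected⇒components≤1 {F = fullE} (λ v → complete z v ◅ ε)) (components>0 z)

support : (Edge n → ℕ) → EdgeSet n
support x e = not (x e ℕ.≡ᵇ 0)

support⁺ : ∀ (x : Edge n → ℕ) e → x e ≢ 0 → T (support x e)
support⁺ x e x[e]≢0 with x e
... | zero  = x[e]≢0 refl
... | suc _ = _

support⁻ : ∀ (x : Edge n → ℕ) e → T (support x e) → x e ≢ 0
support⁻ x e s with x e
... | suc _ = λ ()

suppConn⇒conn : ∀ {x : Edge n → ℕ} → (∀ e → x e ≢ 0 → T (F e)) → Star (SuppAdj x) u v → Conn F u v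
suppConn⇒conn F⊇supp = Star.map λ where
  (e , x[e]≢0 , inj₁ (refl , refl)) → adj e (F⊇supp e x[e]≢0) forward
  (e , x[e]≢0 , inj₂ (refl , refl)) → adj e (F⊇supp e x[e]≢0) backward

xSum-empty : ∀ (x : Edge n → ℕ) Y → ¬ T (any Y (allEdges n)) → xSum x Y ≡ 0
xSum-empty x Y empty = sum-zero _ (allEdges _) λ e → outside e (Y e) refl
  where
  outside : ∀ e b → Y e ≡ b → (if b then x e else 0) ≡ 0
  outside e true  Ye = contradiction (Any.any⁺ Y (lose (∈-allEdges e) (subst T (sym Ye) _))) empty
  outside e false _  = refl

xSum-⊇support : ∀ (x : Edge n → ℕ) Y → (∀ e → x e ≢ 0 → T (Y e)) → xSum x Y ≡ xSum x fullE
xSum-⊇support x Y Y⊇supp = cong sumℕ (map-cong inside (allEdges _))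
  where
  inside : ∀ e → (if Y e then x e else 0) ≡ x e
  inside e with Y e in Ye | x e ℕ.≟ 0
  ... | true  | _          = refl
  ... | false | yes x[e]≡0 = sym x[e]≡0
  ... | false | no x[e]≢0  = ⊥-elim (subst T Ye (Y⊇supp e x[e]≢0))

module _ {n : ℕ} (ρ : Fin n → ℕ) (x : Edge n → ℕ) (z : Fin n) where

  private
    E : List (Edge n)
    E = allEdges n

    half : ℕ
    half = ⌊ ρV ρ /2⌋

  xSum-outside : EdgeSet n → ℕ
  xSum-outside Y = sumℕ (map (λ e → if Y e then 0 else x e) E)

  components≤1+xSum-outside : SuppConnected x → ∀ Y → components Y ≤ 1 + xSum-outside Y
  components≤1+xSum-outside connected Y = begin
    components Y                                       ≤⟨ components-insertAll outside Y ⟩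
    components (insertAll outside Y) + length outside  ≤⟨ ℕ.+-mono-≤ spanning cheap ⟩
    1 + xSum-outside Y                                 ∎
    where
    open ℕ.≤-Reasoning
    outside : List (Edge n)
    outside = filterᵇ (λ e → not (Y e) ∧ support x e) E
    covers : ∀ e → x e ≢ 0 → T (insertAll outside Y e)
    covers e x[e]≢0 with Y e in Ye
    ... | true  = insertAll-⊇ outside (subst T (sym Ye) _)
    ... | false = ∈⇒insertAll (∈-filter⁺ _ (∈-allEdges e)
                    (subst (λ b → T (not b ∧ support x e)) (sym Ye) (support⁺ x e x[e]≢0)))
    spanning : components (insertAll outside Y) ≤ 1
    spanning = connected⇒components≤1 {F = insertAll outside Y} λ v → suppConn⇒conn covers (connected z v)
    positive : ∀ e → T (not (Y e) ∧ support x e) → 0 < (if Y e then 0 else x e)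
    positive e h with Y e
    ... | false = ℕ.n≢0⇒n>0 (support⁻ x e h)
    cheap : length outside ≤ xSum-outside Y
    cheap = length-filter≤sum _ _ E positive

  B⇒Bb' : InB ρ x → InBb' ρ x
  B⇒Bb' (x[E]≡half , connected) = below , trans (cong +_ x[E]≡half) (sym (b'-fullE ρ z))
    where
    below : ∀ Y → + xSum x Y ℤ.≤ b' ρ Y
    below Y with T? (any Y E)
    ... | no empty rewrite xSum-empty x Y empty | b'-empty ρ Y empty = ℤ.≤-refl
    ... | yes nonempty = from (≤b'⇔ ρ Y nonempty (xSum x Y)) (begin
      xSum x Y + components Y          ≤⟨ ℕ.+-monoʳ-≤ (xSum x Y) (components≤1+xSum-outside connected Y) ⟩
      xSum x Y + (1 + xSum-outside Y)  ≡⟨ x∙yz≈y∙xz (xSum x Y) 1 _ ⟩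
      1 + (xSum x Y + xSum-outside Y)  ≡⟨ cong suc (sym (sum-split x Y E)) ⟩
      1 + xSum x fullE                 ≡⟨ ℕ.+-comm 1 _ ⟩
      xSum x fullE + 1                 ≡⟨ cong (_+ 1) x[E]≡half ⟩
      half + 1                         ∎)
      where open ℕ.≤-Reasoning

  Bb'⇒B : InBb' ρ x → InB ρ x
  Bb'⇒B (below , x[E]≡b'[E]) = x[E]≡half , connected
    where
    x[E]≡half : xSum x fullE ≡ half
    x[E]≡half = ℤ.+-injective (trans x[E]≡b'[E] (b'-fullE ρ z))
    -- The loops make Y nonempty even when x = 0, and connect nothing.
    Y : EdgeSet n
    Y e = support x e ∨ ⌊ fst e Fin.≟ snd e ⌋
    loop : Edge n
    loop = edge z z ℕ.≤-refl
    nonempty : T (any Y E)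
    nonempty = Any.any⁺ Y (lose (∈-allEdges loop) (from (T-∨ {support x loop}) (inj₂ (fromWitness refl))))
    x[Y]≡x[E] : xSum x Y ≡ xSum x fullE
    x[Y]≡x[E] = xSum-⊇support x Y λ e x[e]≢0 → from (T-∨ {support x e}) (inj₁ (support⁺ x e x[e]≢0))
    components≤1 : components Y ≤ 1
    components≤1 = ℕ.+-cancelˡ-≤ half _ _ (begin
      half + components Y      ≡⟨ cong (_+ components Y) (trans (sym x[E]≡half) (sym x[Y]≡x[E])) ⟩
      xSum x Y + components Y  ≤⟨ to (≤b'⇔ ρ Y nonempty (xSum x Y)) (below Y) ⟩
      half + 1                 ∎)
      where open ℕ.≤-Reasoning
    drop-loops : ∀ {u v} → Adj Y u v → Star (SuppAdj x) u v
    drop-loops (adj e Ye ends) with to (T-∨ {support x e}) Ye | ends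
    ... | inj₁ s    | forward  = (e , support⁻ x e s , inj₁ (refl , refl)) ◅ ε
    ... | inj₁ s    | backward = (e , support⁻ x e s , inj₂ (refl , refl)) ◅ ε
    ... | inj₂ loop | forward  = subst (Star _ (fst e)) (toWitness loop) ε
    ... | inj₂ loop | backward = subst (Star _ (snd e)) (sym (toWitness loop)) ε
    connected : SuppConnected x
    connected u v = (drop-loops ⋆) (components≤1⇒connected {F = Y} components≤1)

lemma18 : (n : ℕ) (ρ : Fin n → ℕ) → 2 ∣ ρV ρ →
          (x : Edge n → ℕ) → InB ρ x ⇔ InBb' ρ x
lemma18 zero    ρ _ x = mk⇔ (λ _ → (λ _ → ℤ.+≤+ z≤n) , refl) (λ _ → refl , λ ())
lemma18 (suc n) ρ _ x = mk⇔ (B⇒Bb' ρ x Fin.zero) (Bb'⇒B ρ x Fin.zero)
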